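{- Let $H$ be an $r$-uniform hypergraph with $r\geq 3$, and let $H_{p,q}$ be any $(p,q)$-extension of $H$ (as defined in the context). Then $Spec_{(2,2)}(H_{p,q}) = Spec_{(2,2)}(H)$.
   Context: A hypergraph $H$ consists of a finite vertex set $V(H)$ and a family $E(H)$ of subsets of $V(H)$ (edges); it is $r$-uniform if every edge has exactly $r$ vertices. A $(2,2)$-colouring of $H$ is an assignment of colours to the vertices such that every edge contains vertices of exactly two distinct colours. A $k$-$(2,2)$-colouring is a $(2,2)$-colouring using exactly $k$ colours. The $(2,2)$-spectrum $Spec_{(2,2)}(H)$ is the set of all integers $k$ such that $H$ has a $k$-$(2,2)$-colouring. $(p,q)$-extension: Let $H$ be $r$-uniform, $r\ge 3$, and let $E^*=\{v_1,\dots,v_r\}$ be an edge of $H$. Let $W=\{w_1,\dots,w_p\}$ ($p\ge 1$) and $U=\{u_1,\dots,u_q\}$ ($q \ge 0$) be sets of new vertices, pairwise disjoint from each other and from $V(H)$. Let $T$ be a non-empty subset of $\{1,2,\dots,\min\{p,\lfloor (r-1)/2\rfloor\}\}$. If $q\ge 1$, let $P$ be a non-empty subset of $\{1,\dots,\min\{p,r-2\}\}$ and $Q$ a non-empty subset of $\{1,\dots,\min\{q,r-2\}\}$ such that there exist $x\in P$, $y\in Q$ with $x+y\le r-1$. The $(p,q)$-extension $H_{p,q}$ has vertex set $V(H)\cup W\cup U$ and edge set consisting of all edges of $H$ together with: (Type 1) every $r$-set $K\subseteq E^*\cup W$ with $|K\cap W|\in T$; (Type 2, only when $q\ge 1$)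 every $r$-set $K\subseteq E^*\cup W\cup U$ with $|K\cap W|\in P$, $|K\cap U|\in Q$ and $|K\cap W|+|K\cap U|\le r-1$ (so the remaining $r-|K\cap W|-|K\cap U|$ vertices of $K$ lie in $E^*$). When $q=0$ there are no Type 2 edges. -}

module Defs where

open import Data.Nat using (ℕ; _+_; _∸_; _≤_; _<_)
open import Data.Nat.DivMod using (_/_)
open import Data.Fin using (Fin)
open import Data.Fin.Subset using (Subset; _∈_; _⊆_; ∣_∣) renaming (⊥ to ∅)
open import Data.Vec using (_++_)
open import Data.Product using (Σ; ∃; _×_; _,_)
open import Data.Sum using (_⊎_)
open import Function.Definitions using (Surjective)
open import Relation.Binary.PropositionalEquality using (_≡_; _≢_)
open import Function.Bundles using (_⇔_)

Hypergraph : ℕ → Set₁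
Hypergraph n = Subset n → Set

Uniform : {n : ℕ} → ℕ → Hypergraph n → Set
Uniform r H = ∀ e → H e → ∣ e ∣ ≡ r

ExactlyTwoColours : {n k : ℕ} → (Fin n → Fin k) → Subset n → Set
ExactlyTwoColours {n} {k} c e =
  Σ (Fin k) λ a → Σ (Fin k) λ b →
    a ≢ b
    × (∀ v → v ∈ e → (c v ≡ a ⊎ c v ≡ b))
    × (Σ (Fin n) λ v → v ∈ e × c v ≡ a)
    × (Σ (Fin n) λ v → v ∈ e × c v ≡ b)

Is22Colouring : {n k : ℕ} → Hypergraph n → (Fin n → Fin k) → Set
Is22Colouring H c = ∀ e → H e → ExactlyTwoColours c e

-- k ∈ Spec_(2,2)(H): a (2,2)-colouring using exactly k colours
-- (i.e. a colouring onto a k-element colour set).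
InSpec22 : {n : ℕ} → Hypergraph n → ℕ → Set
InSpec22 {n} H k =
  Σ (Fin n → Fin k) λ c → Surjective _≡_ _≡_ c × Is22Colouring H c

SameSpec22 : {n m : ℕ} → Hypergraph n → Hypergraph m → Set
SameSpec22 H H' = ∀ k → InSpec22 H k ⇔ InSpec22 H' k

ValidT : ℕ → ℕ → (ℕ → Set) → Set
ValidT r p T =
  (∀ t → T t → 1 ≤ t × t ≤ p × t ≤ (r ∸ 1) / 2) × (Σ ℕ λ t → T t)

ValidPQ : ℕ → ℕ → ℕ → (ℕ → Set) → (ℕ → Set) → Set
ValidPQ r p q P Q =
  (∀ x → P x → 1 ≤ x × x ≤ p × x ≤ r ∸ 2)
  × (∀ y → Q y → 1 ≤ y × y ≤ q × y ≤ r ∸ 2)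
  × (Σ ℕ λ x → Σ ℕ λ y → P x × Q y × x + y ≤ r ∸ 1)

-- Vertex set Fin (n + (p + q)): the first n vertices
-- are V(H), the next p are W, the last q are U. Every subset of it is
-- uniquely  a ++ (b ++ c)  with a = K ∩ V(H), b = K ∩ W, c = K ∩ U.
ExtEdge : {n : ℕ} (H : Hypergraph n) (r p q : ℕ) (Estar : Subset n)
          (T P Q : ℕ → Set) → Subset n → Subset p → Subset q → Set
ExtEdge H r p q Estar T P Q a b c =
  (H a × b ≡ ∅ × c ≡ ∅)
  ⊎ (a ⊆ Estar × c ≡ ∅ × ∣ a ∣ + ∣ b ∣ ≡ r × T ∣ b ∣)
  ⊎ (1 ≤ q × a ⊆ Estar × ∣ a ∣ + ∣ b ∣ + ∣ c ∣ ≡ r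
       × P ∣ b ∣ × Q ∣ c ∣ × ∣ b ∣ + ∣ c ∣ ≤ r ∸ 1)

Extension : {n : ℕ} (H : Hypergraph n) (r p q : ℕ) (Estar : Subset n)
            (T P Q : ℕ → Set) → Hypergraph (n + (p + q))
Extension {n} H r p q Estar T P Q K =
  Σ (Subset n) λ a → Σ (Subset p) λ b → Σ (Subset q) λ c →
    K ≡ a ++ (b ++ c) × ExtEdge H r p q Estar T P Q a b c

-- Restricting a (2,2)-colouring of H_{p,q} to V(H) keeps all colours: a Type 1
-- edge through two differently coloured vertices of E* forces every vertex of W
-- into the two colours of E*, and a Type 2 edge through a vertex of W and a
-- vertex of E* of the other colour does the same for U.  Conversely, if E* is
-- coloured with α and β, α being the less frequent of the two on E*, colouring
-- W with α and U with β gives a (2,2)-colouring: a Type 1 edge meets E* in more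
-- than r/2 vertices, so it contains a β-vertex.
module Submission where

open import Defs
open import Data.Nat using (ℕ; _≤_; zero; suc; _+_; _*_; _∸_; _<_; z≤n; s≤s; _≤?_)
open import Data.Nat.Properties hiding (_≟_)
open import Data.Nat.DivMod using (_/_; m/n*n≤m)
open import Data.Fin using (Fin; zero; suc; _↑ˡ_; _↑ʳ_; splitAt; fromℕ<)
open import Data.Fin.Properties using (splitAt-↑ˡ; splitAt-↑ʳ; any?; _≟_)
open import Data.Fin.Subset
  using (Subset; _∈_; _∉_; _⊆_; ∣_∣; ⁅_⁆; _∪_; _∩_; ⊤; inside; outside; Nonempty)
  renaming (⊥ to ∅)
open import Data.Fin.Subset.Properties
  using (∉⊥; ∈⊤; ∣⊤∣≡n; x∈⁅x⁆; x∈⁅y⁆⇒x≡y; ∣⁅x⁆∣≡1; p⊆q⇒∣p∣≤∣q∣; x∈p∪q⁻; x∈p∪q⁺;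
         x∈p∩q⁺; x∈p∩q⁻; p∩q⊆p; _∈?_; out⊆; s⊆s; in⊆in; drop-∷-⊆)
open import Data.Vec using ([]; _∷_; _++_; tabulate; here; there)
open import Data.Vec.Properties using ([]=⇒lookup; lookup⇒[]=; lookup∘tabulate)
open import Data.Product using (∃; _×_; _,_; proj₁; proj₂)
open import Data.Sum using (_⊎_; inj₁; inj₂; [_,_]′; swap)
open import Function using (_∘_; const; id)
open import Function.Bundles using (_⇔_; mk⇔; Equivalence)
open import Function.Definitions using (Surjective)
open import Relation.Nullary using (yes; no; does; contradiction)
open import Relation.Nullary.Decidable using (_×-dec_; dec-true)
open import Relation.Binary.PropositionalEquality
  using (_≡_; _≢_; ≢-sym; refl; sym; trans; cong; cong₂; subst; module ≡-Reasoning)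

≤pred⇒< : ∀ {m n} → 1 ≤ m → m ≤ n ∸ 1 → m < n
≤pred⇒< {n = zero}  1≤m m≤0 = contradiction (≤-trans 1≤m m≤0) λ ()
≤pred⇒< {n = suc n} _   m≤n = s≤s m≤n

m≤n/2⇒m+m≤n : ∀ m n → m ≤ n / 2 → m + m ≤ n
m≤n/2⇒m+m≤n m n m≤n/2 = begin
  m + m        ≡⟨ cong (m +_) (sym (+-identityʳ m)) ⟩
  2 * m        ≡⟨ *-comm 2 m ⟩
  m * 2        ≤⟨ *-monoˡ-≤ 2 m≤n/2 ⟩
  n / 2 * 2    ≤⟨ m/n*n≤m n 2 ⟩
  n            ∎
  where open ≤-Reasoning

2≤n∸m : ∀ {m n} → 1 ≤ m → m + m < n → 2 ≤ n ∸ m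
2≤n∸m {m} 1≤m m+m<n = m+n≤o⇒m≤o∸n 2 (≤-trans (s≤s (+-monoˡ-≤ m 1≤m)) m+m<n)

1≤∣p∣⇒nonempty : ∀ {n} (p : Subset n) → 1 ≤ ∣ p ∣ → Nonempty p
1≤∣p∣⇒nonempty (inside  ∷ p) _ = zero , here
1≤∣p∣⇒nonempty (outside ∷ p) h with x , x∈p ← 1≤∣p∣⇒nonempty p h = suc x , there x∈p

∣p∪q∣≤∣p∣+∣q∣ : ∀ {n} (p q : Subset n) → ∣ p ∪ q ∣ ≤ ∣ p ∣ + ∣ q ∣
∣p∪q∣≤∣p∣+∣q∣ []            []            = z≤n
∣p∪q∣≤∣p∣+∣q∣ (inside  ∷ p) (inside  ∷ q) =
  s≤s (≤-trans (∣p∪q∣≤∣p∣+∣q∣ p q) (+-monoʳ-≤ ∣ p ∣ (n≤1+n ∣ q ∣)))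
∣p∪q∣≤∣p∣+∣q∣ (inside  ∷ p) (outside ∷ q) = s≤s (∣p∪q∣≤∣p∣+∣q∣ p q)
∣p∪q∣≤∣p∣+∣q∣ (outside ∷ p) (inside  ∷ q) =
  ≤-trans (s≤s (∣p∪q∣≤∣p∣+∣q∣ p q)) (≤-reflexive (sym (+-suc ∣ p ∣ ∣ q ∣)))
∣p∪q∣≤∣p∣+∣q∣ (outside ∷ p) (outside ∷ q) = ∣p∪q∣≤∣p∣+∣q∣ p q

disjoint⇒∣p∪q∣≡∣p∣+∣q∣ : ∀ {n} (p q : Subset n) → (∀ {x} → x ∈ p → x ∉ q) →
                         ∣ p ∪ q ∣ ≡ ∣ p ∣ + ∣ q ∣
disjoint⇒∣p∪q∣≡∣p∣+∣q∣ []            []            _ = refl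
disjoint⇒∣p∪q∣≡∣p∣+∣q∣ (inside  ∷ p) (inside  ∷ q) d = contradiction here (d here)
disjoint⇒∣p∪q∣≡∣p∣+∣q∣ (inside  ∷ p) (outside ∷ q) d =
  cong suc (disjoint⇒∣p∪q∣≡∣p∣+∣q∣ p q (λ x∈p x∈q → d (there x∈p) (there x∈q)))
disjoint⇒∣p∪q∣≡∣p∣+∣q∣ (outside ∷ p) (inside  ∷ q) d =
  trans (cong suc (disjoint⇒∣p∪q∣≡∣p∣+∣q∣ p q (λ x∈p x∈q → d (there x∈p) (there x∈q))))
        (sym (+-suc ∣ p ∣ ∣ q ∣))
disjoint⇒∣p∪q∣≡∣p∣+∣q∣ (outside ∷ p) (outside ∷ q) d =
  disjoint⇒∣p∪q∣≡∣p∣+∣q∣ p q (λ x∈p x∈q → d (there x∈p) (there x∈q))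

⊆-between : ∀ {n} (x s : Subset n) {m} → x ⊆ s → ∣ x ∣ ≤ m → m ≤ ∣ s ∣ →
            ∃ λ y → x ⊆ y × y ⊆ s × ∣ y ∣ ≡ m
⊆-between []            []            _   _     m≤0 = [] , (λ ()) , (λ ()) , sym (n≤0⇒n≡0 m≤0)
⊆-between (inside  ∷ x) (outside ∷ s) x⊆s _     _   = contradiction (x⊆s here) λ ()
⊆-between (outside ∷ x) (outside ∷ s) x⊆s ∣x∣≤m m≤∣s∣
  with y , x⊆y , y⊆s , ∣y∣≡m ← ⊆-between x s (drop-∷-⊆ x⊆s) ∣x∣≤m m≤∣s∣
  = outside ∷ y , s⊆s x⊆y , s⊆s y⊆s , ∣y∣≡m
⊆-between (inside  ∷ x) (inside  ∷ s) {suc m} x⊆s (s≤s ∣x∣≤m) (s≤s m≤∣s∣)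
  with y , x⊆y , y⊆s , ∣y∣≡m ← ⊆-between x s (drop-∷-⊆ x⊆s) ∣x∣≤m m≤∣s∣
  = inside ∷ y , in⊆in x⊆y , in⊆in y⊆s , cong suc ∣y∣≡m
⊆-between (outside ∷ x) (inside  ∷ s) {m} x⊆s ∣x∣≤m _ with m ≤? ∣ s ∣
... | yes m≤∣s∣
  with y , x⊆y , y⊆s , ∣y∣≡m ← ⊆-between x s (drop-∷-⊆ x⊆s) ∣x∣≤m m≤∣s∣
  = outside ∷ y , s⊆s x⊆y , out⊆ y⊆s , ∣y∣≡m
⊆-between (outside ∷ x) (inside  ∷ s) {suc m} x⊆s _ (s≤s m≤∣s∣) | no m≰∣s∣
  with y , x⊆y , y⊆s , ∣y∣≡m ← ⊆-between x s (drop-∷-⊆ x⊆s)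
                                   (≤-trans (p⊆q⇒∣p∣≤∣q∣ (drop-∷-⊆ x⊆s)) (≤-pred (≰⇒> m≰∣s∣)))
                                   m≤∣s∣
  = inside ∷ y , out⊆ x⊆y , in⊆in y⊆s , cong suc ∣y∣≡m
⊆-between (outside ∷ x) (inside  ∷ s) {zero} _ _ _ | no 0≰∣s∣ = contradiction z≤n 0≰∣s∣

∋-ofSize-⊆ : ∀ {n} {s : Subset n} {x m} → x ∈ s → 1 ≤ m → m ≤ ∣ s ∣ →
             ∃ λ y → x ∈ y × y ⊆ s × ∣ y ∣ ≡ m
∋-ofSize-⊆ {s = s} {x} {m} x∈s 1≤m m≤∣s∣
  with y , x⊆y , y⊆s , ∣y∣≡m ← ⊆-between ⁅ x ⁆ s
                                 (λ x′∈ → subst (_∈ s) (sym (x∈⁅y⁆⇒x≡y x x′∈)) x∈s)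
                                 (subst (_≤ m) (sym (∣⁅x⁆∣≡1 x)) 1≤m) m≤∣s∣
  = y , x⊆y (x∈⁅x⁆ x) , y⊆s , ∣y∣≡m

∋-ofSize : ∀ {n} (x : Fin n) {m} → 1 ≤ m → m ≤ n → ∃ λ y → x ∈ y × ∣ y ∣ ≡ m
∋-ofSize {n} x {m} 1≤m m≤n
  with y , x∈y , _ , ∣y∣≡m ← ∋-ofSize-⊆ ∈⊤ 1≤m (subst (m ≤_) (sym (∣⊤∣≡n n)) m≤n)
  = y , x∈y , ∣y∣≡m

Fin⇒1≤ : ∀ {n} → Fin n → 1 ≤ n
Fin⇒1≤ {suc _} _ = s≤s z≤n

data ++-Split (n m : ℕ) : Fin (n + m) → Set where
  inˡ : (x : Fin n) → ++-Split n m (x ↑ˡ m)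
  inʳ : (y : Fin m) → ++-Split n m (n ↑ʳ y)

++-split : ∀ n {m} (v : Fin (n + m)) → ++-Split n m v
++-split zero    v       = inʳ v
++-split (suc n) zero    = inˡ zero
++-split (suc n) (suc v) with ++-split n v
... | inˡ x = inˡ (suc x)
... | inʳ y = inʳ y

∈-++⁺ˡ : ∀ {n m} {a : Subset n} {b : Subset m} {x} → x ∈ a → x ↑ˡ m ∈ a ++ b
∈-++⁺ˡ here       = here
∈-++⁺ˡ (there x∈a) = there (∈-++⁺ˡ x∈a)

∈-++⁺ʳ : ∀ {n m} (a : Subset n) {b : Subset m} {y} → y ∈ b → n ↑ʳ y ∈ a ++ b
∈-++⁺ʳ []      y∈b = y∈b
∈-++⁺ʳ (_ ∷ a) y∈b = there (∈-++⁺ʳ a y∈b)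

∈-++⁻ˡ : ∀ {n m} (a : Subset n) {b : Subset m} {x} → x ↑ˡ m ∈ a ++ b → x ∈ a
∈-++⁻ˡ (_ ∷ a) {x = zero}  here      = here
∈-++⁻ˡ (_ ∷ a) {x = suc x} (there h) = there (∈-++⁻ˡ a h)

∈-++⁻ʳ : ∀ {n m} (a : Subset n) {b : Subset m} {y} → n ↑ʳ y ∈ a ++ b → y ∈ b
∈-++⁻ʳ []      h         = h
∈-++⁻ʳ (_ ∷ a) (there h) = ∈-++⁻ʳ a h

∉∅++∅ : ∀ {n m} {v : Fin (n + m)} → v ∉ ∅ {n} ++ ∅ {m}
∉∅++∅ {n} {v = v} v∈ with ++-split n v
... | inˡ x = ∉⊥ (∈-++⁻ˡ (∅ {n}) v∈)
... | inʳ y = ∉⊥ (∈-++⁻ʳ (∅ {n}) v∈)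

two-colours-forced : ∀ {n k} (c : Fin n → Fin k) {K : Subset n} → ExactlyTwoColours c K →
                     ∀ {i j v} → i ∈ K → j ∈ K → c i ≢ c j → v ∈ K → c v ≡ c i ⊎ c v ≡ c j
two-colours-forced c (_ , _ , _ , coloured , _) {i} {j} {v} i∈K j∈K ci≢cj v∈K
  with coloured i i∈K | coloured j j∈K | coloured v v∈K
... | inj₁ ci≡α | inj₁ cj≡α | _         = contradiction (trans ci≡α (sym cj≡α)) ci≢cj
... | inj₂ ci≡β | inj₂ cj≡β | _         = contradiction (trans ci≡β (sym cj≡β)) ci≢cj
... | inj₁ ci≡α | inj₂ _    | inj₁ cv≡α = inj₁ (trans cv≡α (sym ci≡α))
... | inj₁ _    | inj₂ cj≡β | inj₂ cv≡β = inj₂ (trans cv≡β (sym cj≡β))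
... | inj₂ _    | inj₁ cj≡α | inj₁ cv≡α = inj₂ (trans cv≡α (sym cj≡α))
... | inj₂ ci≡β | inj₁ _    | inj₂ cv≡β = inj₁ (trans cv≡β (sym ci≡β))

exactlyTwoColours-++-empty :
  ∀ {n m k} {d : Fin (n + m) → Fin k} {c : Fin n → Fin k} {e : Subset n} {g : Subset m} →
  (∀ {y} → y ∉ g) → (∀ x → d (x ↑ˡ m) ≡ c x) →
  ExactlyTwoColours d (e ++ g) ⇔ ExactlyTwoColours c e
exactlyTwoColours-++-empty {n} {m} {d = d} {c} {e} {g} g-empty d≗c = mk⇔ to from
  where
  onE : ∀ {γ} {v} → v ∈ e ++ g → d v ≡ γ → ∃ λ x → x ∈ e × c x ≡ γ
  onE {v = v} v∈ dv≡γ with ++-split n v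
  ... | inˡ x = x , ∈-++⁻ˡ e v∈ , trans (sym (d≗c x)) dv≡γ
  ... | inʳ y = contradiction (∈-++⁻ʳ e v∈) g-empty

  to : ExactlyTwoColours d (e ++ g) → ExactlyTwoColours c e
  to (α , β , α≢β , coloured , (v , v∈ , dv≡α) , (w , w∈ , dw≡β)) =
    α , β , α≢β ,
    (λ x x∈e → subst (λ γ → γ ≡ α ⊎ γ ≡ β) (d≗c x) (coloured (x ↑ˡ m) (∈-++⁺ˡ x∈e))) ,
    onE v∈ dv≡α , onE w∈ dw≡β

  from : ExactlyTwoColours c e → ExactlyTwoColours d (e ++ g)
  from (α , β , α≢β , coloured , (x , x∈ , cx≡α) , (y , y∈ , cy≡β)) =
    α , β , α≢β , coloured′ ,
    (x ↑ˡ m , ∈-++⁺ˡ x∈ , trans (d≗c x) cx≡α) , (y ↑ˡ m , ∈-++⁺ˡ y∈ , trans (d≗c y) cy≡β)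
    where
    coloured′ : ∀ v → v ∈ e ++ g → d v ≡ α ⊎ d v ≡ β
    coloured′ v v∈ with ++-split n v
    ... | inˡ x = subst (λ γ → γ ≡ α ⊎ γ ≡ β) (sym (d≗c x)) (coloured x (∈-++⁻ˡ e v∈))
    ... | inʳ y = contradiction (∈-++⁻ʳ e v∈) g-empty

restriction-surjective : ∀ {n m k} (d : Fin (n + m) → Fin k) → Surjective _≡_ _≡_ d →
                         (∀ y → ∃ λ x → d (n ↑ʳ y) ≡ d (x ↑ˡ m)) →
                         Surjective _≡_ _≡_ (d ∘ (_↑ˡ m))
restriction-surjective {n} d d-onto shared γ with d-onto γ
... | v , dv≡γ with ++-split n v
...   | inˡ x = x , λ { refl → dv≡γ refl }
...   | inʳ y with x , dy≡dx ← shared y = x , λ { refl → trans (sym dy≡dx) (dv≡γ refl) }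

fibre : ∀ {n k} → (Fin n → Fin k) → Fin k → Subset n
fibre c γ = tabulate λ v → does (c v ≟ γ)

∈-fibre⁺ : ∀ {n k} {c : Fin n → Fin k} {γ v} → c v ≡ γ → v ∈ fibre c γ
∈-fibre⁺ {c = c} {γ} {v} cv≡γ =
  lookup⇒[]= v _ (trans (lookup∘tabulate _ v) (dec-true (c v ≟ γ) cv≡γ))

∈-fibre⁻ : ∀ {n k} {c : Fin n → Fin k} {γ v} → v ∈ fibre c γ → c v ≡ γ
∈-fibre⁻ {c = c} {γ} {v} v∈
  with c v ≟ γ | trans (sym (lookup∘tabulate (λ v → does (c v ≟ γ)) v)) ([]=⇒lookup v∈)
... | yes cv≡γ | _ = cv≡γ
... | no  _    | ()

minority-bound : ∀ {n k} (c : Fin n → Fin k) (s : Subset n) {α β} → α ≢ β →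
                 ∣ s ∩ fibre c α ∣ ≤ ∣ s ∩ fibre c β ∣ →
                 ∀ {a} → a ⊆ s → (∀ {v} → v ∈ a → c v ≡ α) → ∣ a ∣ + ∣ a ∣ ≤ ∣ s ∣
minority-bound c s {α} {β} α≢β Sα≤Sβ {a} a⊆s mono = begin
  ∣ a ∣ + ∣ a ∣    ≤⟨ +-mono-≤ a≤Sα (≤-trans a≤Sα Sα≤Sβ) ⟩
  ∣ Sα ∣ + ∣ Sβ ∣  ≡⟨ disjoint⇒∣p∪q∣≡∣p∣+∣q∣ Sα Sβ disjoint ⟨
  ∣ Sα ∪ Sβ ∣      ≤⟨ p⊆q⇒∣p∣≤∣q∣ Sα∪Sβ⊆s ⟩
  ∣ s ∣            ∎
  where
  open ≤-Reasoning
  Sα = s ∩ fibre c α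
  Sβ = s ∩ fibre c β
  a≤Sα : ∣ a ∣ ≤ ∣ Sα ∣
  a≤Sα = p⊆q⇒∣p∣≤∣q∣ λ v∈a → x∈p∩q⁺ (a⊆s v∈a , ∈-fibre⁺ {c = c} (mono v∈a))
  disjoint : ∀ {v} → v ∈ Sα → v ∉ Sβ
  disjoint v∈Sα v∈Sβ =
    α≢β (trans (sym (∈-fibre⁻ {c = c} (proj₂ (x∈p∩q⁻ s _ v∈Sα))))
               (∈-fibre⁻ {c = c} (proj₂ (x∈p∩q⁻ s _ v∈Sβ))))
  Sα∪Sβ⊆s : Sα ∪ Sβ ⊆ s
  Sα∪Sβ⊆s v∈ = [ p∩q⊆p s _ , p∩q⊆p s _ ]′ (x∈p∪q⁻ Sα Sβ v∈)

module ExtensionSpectrum {n r p q : ℕ} (H : Hypergraph n) (Estar : Subset n)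
  (T P Q : ℕ → Set) (H-Estar : H Estar) (∣Estar∣≡r : ∣ Estar ∣ ≡ r)
  (valid-T : ValidT r p T) (valid-PQ : 1 ≤ q → ValidPQ r p q P Q) where

  Ext : Hypergraph (n + (p + q))
  Ext = Extension H r p q Estar T P Q

  inV : Fin n → Fin (n + (p + q))
  inV x = x ↑ˡ (p + q)

  inW : Fin p → Fin (n + (p + q))
  inW w = n ↑ʳ (w ↑ˡ q)

  inU : Fin q → Fin (n + (p + q))
  inU u = n ↑ʳ (p ↑ʳ u)

  T-bounds : ∀ {s} → T s → 1 ≤ s × s ≤ p × s + s < r
  T-bounds {s} s∈T with 1≤s , s≤p , s≤[r∸1]/2 ← proj₁ valid-T s s∈T =
    1≤s , s≤p , ≤pred⇒< (≤-trans 1≤s (m≤m+n s s)) (m≤n/2⇒m+m≤n s (r ∸ 1) s≤[r∸1]/2)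

  1≤p : 1 ≤ p
  1≤p with _ , t∈T ← proj₂ valid-T with 1≤t , t≤p , _ ← T-bounds t∈T = ≤-trans 1≤t t≤p

  type1-edge-through : ∀ {i j} → i ∈ Estar → j ∈ Estar → ∀ w →
                       ∃ λ K → Ext K × inV i ∈ K × inV j ∈ K × inW w ∈ K
  type1-edge-through {i} {j} i∈E j∈E w
    with t , t∈T ← proj₂ valid-T
    with 1≤t , t≤p , t+t<r ← T-bounds t∈T
    = edge (⊆-between (⁅ i ⁆ ∪ ⁅ j ⁆) Estar ij⊆E ∣ij∣≤r∸t r∸t≤∣E∣) (∋-ofSize w 1≤t t≤p)
    where
    ij⊆E : ⁅ i ⁆ ∪ ⁅ j ⁆ ⊆ Estar
    ij⊆E v∈ij with x∈p∪q⁻ ⁅ i ⁆ ⁅ j ⁆ v∈ij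
    ... | inj₁ v∈i = subst (_∈ Estar) (sym (x∈⁅y⁆⇒x≡y i v∈i)) i∈E
    ... | inj₂ v∈j = subst (_∈ Estar) (sym (x∈⁅y⁆⇒x≡y j v∈j)) j∈E

    ∣ij∣≤r∸t : ∣ ⁅ i ⁆ ∪ ⁅ j ⁆ ∣ ≤ r ∸ t
    ∣ij∣≤r∸t = ≤-trans (∣p∪q∣≤∣p∣+∣q∣ ⁅ i ⁆ ⁅ j ⁆)
                 (subst (_≤ r ∸ t) (sym (cong₂ _+_ (∣⁅x⁆∣≡1 i) (∣⁅x⁆∣≡1 j))) (2≤n∸m 1≤t t+t<r))

    r∸t≤∣E∣ : r ∸ t ≤ ∣ Estar ∣
    r∸t≤∣E∣ = subst (r ∸ t ≤_) (sym ∣Estar∣≡r) (m∸n≤m r t)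

    edge : (∃ λ a → ⁅ i ⁆ ∪ ⁅ j ⁆ ⊆ a × a ⊆ Estar × ∣ a ∣ ≡ r ∸ t) →
           (∃ λ b → w ∈ b × ∣ b ∣ ≡ t) →
           ∃ λ K → Ext K × inV i ∈ K × inV j ∈ K × inW w ∈ K
    edge (a , ij⊆a , a⊆E , ∣a∣≡r∸t) (b , w∈b , ∣b∣≡t) =
      a ++ (b ++ ∅) ,
      (a , b , ∅ , refl , inj₂ (inj₁ (a⊆E , refl , size , subst T (sym ∣b∣≡t) t∈T))) ,
      ∈-++⁺ˡ (ij⊆a (x∈p∪q⁺ (inj₁ (x∈⁅x⁆ i)))) , ∈-++⁺ˡ (ij⊆a (x∈p∪q⁺ (inj₂ (x∈⁅x⁆ j)))) ,
      ∈-++⁺ʳ a (∈-++⁺ˡ w∈b)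
      where
      size : ∣ a ∣ + ∣ b ∣ ≡ r
      size = trans (cong₂ _+_ ∣a∣≡r∸t ∣b∣≡t) (m∸n+n≡m (≤-trans (m≤m+n t t) (<⇒≤ t+t<r)))

  type2-edge-through : ∀ {o} → o ∈ Estar → ∀ w u →
                       ∃ λ K → Ext K × inV o ∈ K × inW w ∈ K × inU u ∈ K
  type2-edge-through {o} o∈E w u
    with P-bounds , Q-bounds , x , y , x∈P , y∈Q , x+y≤r∸1 ← valid-PQ (Fin⇒1≤ u)
    with 1≤x , x≤p , _ ← P-bounds x x∈P
    with 1≤y , y≤q , _ ← Q-bounds y y∈Q
    = edge (∋-ofSize-⊆ o∈E (m<n⇒0<n∸m x+y<r) r∸[x+y]≤∣E∣)
           (∋-ofSize w 1≤x x≤p) (∋-ofSize u 1≤y y≤q)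
    where
    x+y<r : x + y < r
    x+y<r = ≤pred⇒< (≤-trans 1≤x (m≤m+n x y)) x+y≤r∸1

    r∸[x+y]≤∣E∣ : r ∸ (x + y) ≤ ∣ Estar ∣
    r∸[x+y]≤∣E∣ = subst (r ∸ (x + y) ≤_) (sym ∣Estar∣≡r) (m∸n≤m r (x + y))

    edge : (∃ λ a → o ∈ a × a ⊆ Estar × ∣ a ∣ ≡ r ∸ (x + y)) →
           (∃ λ b → w ∈ b × ∣ b ∣ ≡ x) → (∃ λ c → u ∈ c × ∣ c ∣ ≡ y) →
           ∃ λ K → Ext K × inV o ∈ K × inW w ∈ K × inU u ∈ K
    edge (a , o∈a , a⊆E , ∣a∣≡r∸[x+y]) (b , w∈b , ∣b∣≡x) (c , u∈c , ∣c∣≡y) =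
      a ++ (b ++ c) ,
      (a , b , c , refl , inj₂ (inj₂ (Fin⇒1≤ u , a⊆E , size , subst P (sym ∣b∣≡x) x∈P ,
                                      subst Q (sym ∣c∣≡y) y∈Q ,
                                      subst (_≤ r ∸ 1) (sym (cong₂ _+_ ∣b∣≡x ∣c∣≡y)) x+y≤r∸1))) ,
      ∈-++⁺ˡ o∈a , ∈-++⁺ʳ a (∈-++⁺ˡ w∈b) , ∈-++⁺ʳ a (∈-++⁺ʳ b u∈c)
      where
      size : ∣ a ∣ + ∣ b ∣ + ∣ c ∣ ≡ r
      size = begin
        ∣ a ∣ + ∣ b ∣ + ∣ c ∣      ≡⟨ cong₂ _+_ (cong₂ _+_ ∣a∣≡r∸[x+y] ∣b∣≡x) ∣c∣≡y ⟩
        r ∸ (x + y) + x + y        ≡⟨ +-assoc (r ∸ (x + y)) x y ⟩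
        r ∸ (x + y) + (x + y)      ≡⟨ m∸n+n≡m (<⇒≤ x+y<r) ⟩
        r                          ∎
        where open ≡-Reasoning

  module Restriction {k} (d : Fin (n + (p + q)) → Fin k) (d-is22 : Is22Colouring Ext d) where

    d∣H : Fin n → Fin k
    d∣H = d ∘ inV

    d∣H-is22 : Is22Colouring H d∣H
    d∣H-is22 e e∈H = Equivalence.to (exactlyTwoColours-++-empty (∉∅++∅ {p} {q}) (λ _ → refl))
                       (d-is22 _ (e , ∅ , ∅ , refl , inj₁ (e∈H , refl , refl)))

    module _ {i j} (i∈E : i ∈ Estar) (j∈E : j ∈ Estar) (di≢dj : d (inV i) ≢ d (inV j)) where

      W-coloured : ∀ w → d (inW w) ≡ d (inV i) ⊎ d (inW w) ≡ d (inV j)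
      W-coloured w with K , K∈Ext , i∈K , j∈K , w∈K ← type1-edge-through i∈E j∈E w
        = two-colours-forced d (d-is22 K K∈Ext) i∈K j∈K di≢dj w∈K

      U-beside : ∀ {o} → o ∈ Estar → ∀ w u → d (inW w) ≢ d (inV o) →
                 d (inU u) ≡ d (inW w) ⊎ d (inU u) ≡ d (inV o)
      U-beside o∈E w u dw≢do with K , K∈Ext , o∈K , w∈K , u∈K ← type2-edge-through o∈E w u
        = two-colours-forced d (d-is22 K K∈Ext) w∈K o∈K dw≢do u∈K

      w₀ : Fin p
      w₀ = fromℕ< 1≤p

      U-coloured : ∀ u → d (inU u) ≡ d (inV i) ⊎ d (inU u) ≡ d (inV j)
      U-coloured u with W-coloured w₀
      ... | inj₁ dw≡di = [ (λ du≡dw → inj₁ (trans du≡dw dw≡di)) , inj₂ ]′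
                           (U-beside j∈E w₀ u (λ dw≡dj → di≢dj (trans (sym dw≡di) dw≡dj)))
      ... | inj₂ dw≡dj = [ (λ du≡dw → inj₂ (trans du≡dw dw≡dj)) , inj₁ ]′
                           (U-beside i∈E w₀ u (λ dw≡di → di≢dj (trans (sym dw≡di) dw≡dj)))

    extra-vertices-reuse-colours : ∀ y → ∃ λ x → d (n ↑ʳ y) ≡ d∣H x
    extra-vertices-reuse-colours y
      with _ , _ , α≢β , _ , (i , i∈E , di≡α) , (j , j∈E , dj≡β) ← d∣H-is22 Estar H-Estar
      = reuse (++-split p y)
      where
      di≢dj : d∣H i ≢ d∣H j
      di≢dj di≡dj = α≢β (trans (sym di≡α) (trans di≡dj dj≡β))

      choose : ∀ {v} → d v ≡ d∣H i ⊎ d v ≡ d∣H j → ∃ λ x → d v ≡ d∣H x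
      choose = [ (i ,_) , (j ,_) ]′

      reuse : ∀ {y} → ++-Split p q y → ∃ λ x → d (n ↑ʳ y) ≡ d∣H x
      reuse (inˡ w) = choose (W-coloured i∈E j∈E di≢dj w)
      reuse (inʳ u) = choose (U-coloured i∈E j∈E di≢dj u)

  restriction-inSpec : ∀ {k} → InSpec22 Ext k → InSpec22 H k
  restriction-inSpec (d , d-onto , d-is22) =
    d∣H , restriction-surjective d d-onto extra-vertices-reuse-colours , d∣H-is22
    where open Restriction d d-is22

  module Extending {k} (c : Fin n → Fin k) (α β : Fin k) where

    c⁺ : Fin (n + (p + q)) → Fin k
    c⁺ v = [ c , [ const α , const β ]′ ∘ splitAt p ]′ (splitAt n v)

    c⁺-inV : ∀ x → c⁺ (inV x) ≡ c x
    c⁺-inV x rewrite splitAt-↑ˡ n x (p + q) = refl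

    c⁺-inW : ∀ w → c⁺ (inW w) ≡ α
    c⁺-inW w rewrite splitAt-↑ʳ n (p + q) (w ↑ˡ q) | splitAt-↑ˡ p w q = refl

    c⁺-inU : ∀ u → c⁺ (inU u) ≡ β
    c⁺-inU u rewrite splitAt-↑ʳ n (p + q) (p ↑ʳ u) | splitAt-↑ʳ p q u = refl

    c⁺-surjective : Surjective _≡_ _≡_ c → Surjective _≡_ _≡_ c⁺
    c⁺-surjective c-onto γ with x , cx≡γ ← c-onto γ =
      inV x , λ { refl → trans (c⁺-inV x) (cx≡γ refl) }

    module _ (α≢β : α ≢ β) (Estar-coloured : ∀ v → v ∈ Estar → c v ≡ α ⊎ c v ≡ β)
             (α-minority : ∣ Estar ∩ fibre c α ∣ ≤ ∣ Estar ∩ fibre c β ∣) where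

      two-coloured : ∀ {a : Subset n} {b : Subset p} {e : Subset q} → a ⊆ Estar →
                     ∀ v → v ∈ a ++ (b ++ e) → c⁺ v ≡ α ⊎ c⁺ v ≡ β
      two-coloured {a} a⊆E v v∈ with ++-split n v
      ... | inˡ x =
        subst (λ γ → γ ≡ α ⊎ γ ≡ β) (sym (c⁺-inV x)) (Estar-coloured x (a⊆E (∈-++⁻ˡ a v∈)))
      ... | inʳ y with ++-split p y
      ...   | inˡ w = inj₁ (c⁺-inW w)
      ...   | inʳ u = inj₂ (c⁺-inU u)

      β-vertex : ∀ {a : Subset n} {b : Subset p} → a ⊆ Estar → ∣ a ∣ + ∣ b ∣ ≡ r → T ∣ b ∣ →
                 ∃ λ x → x ∈ a × c x ≡ β
      β-vertex {a} {b} a⊆E size b∈T with any? (λ x → (x ∈? a) ×-dec (c x ≟ β))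
      ... | yes found = found
      ... | no  none  = contradiction a+a≤r (<⇒≱ r<a+a)
        where
        a-monochromatic : ∀ {v} → v ∈ a → c v ≡ α
        a-monochromatic {v} v∈a = [ id , (λ cv≡β → contradiction (v , v∈a , cv≡β) none) ]′
                                    (Estar-coloured v (a⊆E v∈a))
        a+a≤r : ∣ a ∣ + ∣ a ∣ ≤ r
        a+a≤r = subst (∣ a ∣ + ∣ a ∣ ≤_) ∣Estar∣≡r
                  (minority-bound c Estar α≢β α-minority a⊆E a-monochromatic)
        b<a : ∣ b ∣ < ∣ a ∣
        b<a = +-cancelʳ-< (∣ b ∣) (∣ b ∣) (∣ a ∣)
                (subst (∣ b ∣ + ∣ b ∣ <_) (sym size) (proj₂ (proj₂ (T-bounds b∈T))))
        r<a+a : r < ∣ a ∣ + ∣ a ∣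
        r<a+a = subst (_< ∣ a ∣ + ∣ a ∣) size (+-monoʳ-< ∣ a ∣ b<a)

      c⁺-is22 : Is22Colouring H c → Is22Colouring Ext c⁺
      c⁺-is22 c-is22 _ (a , _ , _ , refl , inj₁ (a∈H , refl , refl)) =
        Equivalence.from (exactlyTwoColours-++-empty (∉∅++∅ {p} {q}) c⁺-inV) (c-is22 a a∈H)
      c⁺-is22 _ _ (a , b , _ , refl , inj₂ (inj₁ (a⊆E , refl , size , b∈T)))
        with w , w∈b ← 1≤∣p∣⇒nonempty b (proj₁ (T-bounds b∈T))
        with x , x∈a , cx≡β ← β-vertex {b = b} a⊆E size b∈T
        = α , β , α≢β , two-coloured {b = b} a⊆E ,
          (inW w , ∈-++⁺ʳ a (∈-++⁺ˡ w∈b) , c⁺-inW w) ,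
          (inV x , ∈-++⁺ˡ x∈a , trans (c⁺-inV x) cx≡β)
      c⁺-is22 _ _ (a , b , e , refl , inj₂ (inj₂ (1≤q , a⊆E , _ , b∈P , e∈Q , _)))
        with P-bounds , Q-bounds , _ ← valid-PQ 1≤q
        with w , w∈b ← 1≤∣p∣⇒nonempty b (proj₁ (P-bounds _ b∈P))
        with u , u∈e ← 1≤∣p∣⇒nonempty e (proj₁ (Q-bounds _ e∈Q))
        = α , β , α≢β , two-coloured {b = b} {e} a⊆E ,
          (inW w , ∈-++⁺ʳ a (∈-++⁺ˡ w∈b) , c⁺-inW w) ,
          (inU u , ∈-++⁺ʳ a (∈-++⁺ʳ b u∈e) , c⁺-inU u)

  extension-inSpec : ∀ {k} → InSpec22 H k → InSpec22 Ext k
  extension-inSpec (c , c-onto , c-is22)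
    with α , β , α≢β , Estar-coloured , _ ← c-is22 Estar H-Estar
    with ∣ Estar ∩ fibre c α ∣ ≤? ∣ Estar ∩ fibre c β ∣
  ... | yes Sα≤Sβ = c⁺ , c⁺-surjective c-onto , c⁺-is22 α≢β Estar-coloured Sα≤Sβ c-is22
    where open Extending c α β
  ... | no  Sα≰Sβ = c⁺ , c⁺-surjective c-onto ,
                    c⁺-is22 (≢-sym α≢β) (λ v → swap ∘ Estar-coloured v) (<⇒≤ (≰⇒> Sα≰Sβ)) c-is22
    where open Extending c β α

  spectrum : SameSpec22 Ext H
  spectrum k = mk⇔ restriction-inSpec extension-inSpec

-- 3 ≤ r and 1 ≤ p already follow from ValidT, and uniformity is needed only for ∣E*∣ = r.
theorem2p2 : (n r p q : ℕ) (H : Hypergraph n) → 3 ≤ r → Uniform r H →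
    (Estar : Subset n) → H Estar → 1 ≤ p →
    (T P Q : ℕ → Set) → ValidT r p T → (1 ≤ q → ValidPQ r p q P Q) →
    SameSpec22 (Extension H r p q Estar T P Q) H
theorem2p2 n r p q H _ uniform Estar H-Estar _ T P Q valid-T valid-PQ =
  ExtensionSpectrum.spectrum H Estar T P Q H-Estar (uniform Estar H-Estar) valid-T valid-PQ
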